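{- Let $G$ be a connected finite graph, let $n > 0$, and let $f, g : \mathsf{Hom}(C_n, G)$ be edge-injective graph homomorphisms. Then the type $$\sum_{e : C_n = C_n} \big(\mathsf{tr}^{\lambda X.\mathsf{Hom}(X,G)}(e, f) = g\big)$$ is a proposition.
   Context: Work in homotopy type theory with a univalent universe $\mathcal{U}$ and propositional truncation. A graph $G$ consists of a set $N_G$ of nodes and a set-valued family $E_G:N_G\to N_G\to\mathcal{U}$; $\mathsf{Graph}$ is the type of graphs, so $C_n = C_n$ is an identity type in $\mathsf{Graph}$. A homomorphism $(\alpha,\beta):G\to H$ consists of $\alpha:N_G\to N_H$ and $\beta:\prod_{x,y}E_G(x,y)\to E_H(\alpha x,\alpha y)$; $\mathsf{Hom}(G,H)$ is their type. $(\alpha,\beta)$ is edge-injective if the map $\sum_{x,y:N_G}E_G(x,y)\to\sum_{x,y:N_H}E_H(x,y)$, $(x,y,e)\mapsto(\alpha x,\alpha y,\beta(x,y,e))$, is an embedding. $G$ is finite if $N_G$ and all $E_G(x,y)$ are finite types, connected if a walk merely exists between any two nodes. $[n]$ is the standard finite set $\{0,\dots,n-1\}$, $\mathsf{pred}:[n]\to[n]$ sends $0\mapsto n-1$, $i+1\mapsto i$; for $n\ge1$ the cycle graph $C_n$ has nodes $[n]$ and edges $E_{C_n}(u,v):\equiv(u=\mathsf{pred}(v))$. $\mathsf{tr}^{P}(e,-)$ denotes transport along $e$ in the family $P$. -}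

{-# OPTIONS --without-K #-}
module Defs where

-- Book-HoTT setting inside MLTT without K (as in TypeTopology / HoTT-UF in Agda):
-- univalence and propositional truncation are NOT available as primitives, so they
-- are made explicit notions here and taken as hypotheses of the theorem.

open import Level using (Level; _⊔_; Setω) renaming (suc to lsuc; zero to lzero)
open import Data.Nat using (ℕ; zero; suc; NonZero)
open import Data.Fin using (Fin; zero; suc; fromℕ; inject₁)
open import Data.Fin.Properties using (_≟_)
open import Data.Product using (Σ; _,_; proj₁; proj₂; _×_)
open import Relation.Binary.PropositionalEquality using (_≡_; refl; sym; trans; cong)
open import Axiom.UniquenessOfIdentityProofs using (module Decidable⇒UIP)

private variable ℓ ℓ' : Level

isContr : Set ℓ → Set ℓ
isContr A = Σ A λ c → (x : A) → c ≡ x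

isProp : Set ℓ → Set ℓ
isProp A = (x y : A) → x ≡ y

isSet : Set ℓ → Set ℓ
isSet A = (x y : A) → isProp (x ≡ y)

fiber : {A : Set ℓ} {B : Set ℓ'} → (A → B) → B → Set (ℓ ⊔ ℓ')
fiber {A = A} f b = Σ A λ a → f a ≡ b

isEquiv : {A : Set ℓ} {B : Set ℓ'} → (A → B) → Set (ℓ ⊔ ℓ')
isEquiv {B = B} f = (b : B) → isContr (fiber f b)

_≃_ : Set ℓ → Set ℓ' → Set (ℓ ⊔ ℓ')
A ≃ B = Σ (A → B) isEquiv

idIsEquiv : (A : Set ℓ) → isEquiv (λ (x : A) → x)
idIsEquiv A b = (b , refl) , λ { (a , refl) → refl }

idtoeqv : {A B : Set ℓ} → A ≡ B → A ≃ B
idtoeqv {A = A} refl = (λ x → x) , idIsEquiv A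

Univalence : (ℓ : Level) → Set (lsuc ℓ)
Univalence ℓ = (A B : Set ℓ) → isEquiv (idtoeqv {A = A} {B = B})

isEmbedding : {A : Set ℓ} {B : Set ℓ'} → (A → B) → Set (ℓ ⊔ ℓ')
isEmbedding {A = A} f = (x y : A) → isEquiv (cong f {x} {y})

record PropTrunc : Setω where
  field
    ∥_∥      : {ℓ : Level} → Set ℓ → Set ℓ
    ∣_∣      : {ℓ : Level} {A : Set ℓ} → A → ∥ A ∥
    ∥∥-isProp : {ℓ : Level} {A : Set ℓ} → isProp ∥ A ∥
    ∥∥-rec    : {ℓ ℓ' : Level} {A : Set ℓ} {P : Set ℓ'} → isProp P → (A → P) → ∥ A ∥ → P

record Graph : Set₁ where
  field
    Node      : Set
    Node-set  : isSet Node
    Edge      : Node → Node → Set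
    Edge-set  : (x y : Node) → isSet (Edge x y)
open Graph public

Hom : Graph → Graph → Set
Hom G H = Σ (Node G → Node H) λ α → (x y : Node G) → Edge G x y → Edge H (α x) (α y)

TotalEdges : Graph → Set
TotalEdges G = Σ (Node G) λ x → Σ (Node G) λ y → Edge G x y

edgeMap : {G H : Graph} → Hom G H → TotalEdges G → TotalEdges H
edgeMap (α , β) (x , y , e) = α x , α y , β x y e

isEdgeInjective : {G H : Graph} → Hom G H → Set
isEdgeInjective {G} {H} φ = isEmbedding (edgeMap {G} {H} φ)

data Walk (G : Graph) : Node G → Node G → Set where
  nil  : (x : Node G) → Walk G x x
  fwd  : {x y z : Node G} → Edge G x y → Walk G y z → Walk G x z
  bwd  : {x y z : Node G} → Edge G y x → Walk G y z → Walk G x z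

module _ (T : PropTrunc) where
  open PropTrunc T

  isFinite : Set → Set
  isFinite A = Σ ℕ λ k → ∥ A ≃ Fin k ∥

  isFiniteGraph : Graph → Set
  isFiniteGraph G = isFinite (Node G) × ((x y : Node G) → isFinite (Edge G x y))

  isConnected : Graph → Set
  isConnected G = (x y : Node G) → ∥ Walk G x y ∥

predFin : {m : ℕ} → Fin (suc m) → Fin (suc m)
predFin {m} zero = fromℕ m
predFin (suc i) = inject₁ i

Fin-isSet : (k : ℕ) → isSet (Fin k)
Fin-isSet k x y = Decidable⇒UIP.≡-irrelevant _≟_

prop→set : {A : Set ℓ} → isProp A → isSet A
prop→set {A = A} p x y q r = trans (lem q) (sym (lem r))
  where
  g : (z : A) → x ≡ z
  g z = p x z
  lem : {z : A} (s : x ≡ z) → s ≡ trans (sym (g x)) (g z)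
  lem {z} refl = sym (trans-symˡ (g x))
    where
    trans-symˡ : {a b : A} (t : a ≡ b) → trans (sym t) t ≡ refl
    trans-symˡ refl = refl

Cycle : (n : ℕ) → .{{NonZero n}} → Graph
Cycle (suc m) = record
  { Node     = Fin (suc m)
  ; Node-set = Fin-isSet (suc m)
  ; Edge     = λ u v → u ≡ predFin v
  ; Edge-set = λ u v → prop→set (Fin-isSet (suc m) u (predFin v))
  }

{-# OPTIONS --safe #-}
{-# OPTIONS --without-K #-}
module Submission where

-- Transport along a graph path e : X = X acts on homomorphisms X → G by moving edges, so
-- if tr(e, f) = f then edge-injectivity of f forces e to fix every edge of X and hence,
-- each node of a cycle being the target of an edge, every node.  By univalence a path
-- between graphs whose edges form propositions is determined by its action on nodes, so
-- e = refl.  Thus e ↦ tr(e, f) is injective into the set Hom(Cₙ, G) and its fibres are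
-- propositions.

open import Defs
open import Level using (Level; _⊔_; lift; lower)
open import Data.Nat using (ℕ; NonZero; suc)
open import Data.Product using (Σ; _,_; proj₁; proj₂)
open import Data.Product.Properties using (Σ-≡,≡→≡; Σ-≡,≡←≡)
open import Relation.Binary.PropositionalEquality
  using (_≡_; refl; sym; trans; cong; cong₂; cong-app; subst)
open import Relation.Binary.PropositionalEquality.Properties using (trans-symˡ)

private variable a b : Level

isContr→isProp : {A : Set a} → isContr A → isProp A
isContr→isProp (c , h) x y = trans (sym (h x)) (h y)

isContr-retract : {X : Set a} {Y : Set b} (r : X → Y) (s : Y → X) →
                  (∀ y → r (s y) ≡ y) → isContr X → isContr Y
isContr-retract r s rs (c , h) = r c , λ y → trans (cong r (h (s y))) (rs y)

singleton-isContr : {A : Set a} (x : A) → isContr (Σ A λ y → x ≡ y)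
singleton-isContr x = (x , refl) , λ { (_ , refl) → refl }

-- No law relating decode to encode is needed: decode is normalised so that it
-- sends encode refl to refl, and then it is a retraction of encode by path induction.
encode-injective : {A : Set a} {x : A} {D : A → Set b}
                   (encode : ∀ {y} → x ≡ y → D y) (decode : ∀ {y} → D y → x ≡ y) →
                   ∀ {y} {p q : x ≡ y} → encode p ≡ encode q → p ≡ q
encode-injective {x = x} {D} encode decode {p = p} {q} eq =
  trans (sym (retraction p)) (trans (cong decode′ eq) (retraction q))
  where
  decode′ : ∀ {y} → D y → x ≡ y
  decode′ d = trans (sym (decode (encode refl))) (decode d)
  retraction : ∀ {y} (r : x ≡ y) → decode′ (encode r) ≡ r
  retraction refl = trans-symˡ (decode (encode refl))

injective⇒fiber-isProp : {A : Set a} {B : Set b} (f : A → B) → isSet B →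
                         (∀ {x y} → f x ≡ f y → x ≡ y) → (y : B) → isProp (fiber f y)
injective⇒fiber-isProp f setB inj y (x , p) (x′ , p′) =
  Σ-≡,≡→≡ (inj (trans p (sym p′)) , setB _ _ _ _)

module FromUnivalence (ua : (ℓ : Level) → Univalence ℓ) where

  -- By univalence h is idtoeqv p for a path p, and for p = refl postcomposition is the identity.
  postcomp-isEquiv : ∀ {k} {A : Set a} {X Y : Set k} (h : X → Y) → isEquiv h →
                     isEquiv (λ (φ : A → X) x → h (φ x))
  postcomp-isEquiv {k = k} {A = A} {X} {Y} h eh =
    subst (λ h′ → isEquiv (λ (φ : A → X) x → h′ (φ x))) (cong proj₁ idtoeqv-p≡h) (along p)
    where
    p : X ≡ Y
    p = proj₁ (proj₁ (ua k X Y (h , eh)))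
    idtoeqv-p≡h : idtoeqv p ≡ (h , eh)
    idtoeqv-p≡h = proj₂ (proj₁ (ua k X Y (h , eh)))
    along : {Z : Set k} (q : X ≡ Z) → isEquiv (λ (φ : A → X) x → proj₁ (idtoeqv q) (φ x))
    along refl = idIsEquiv (A → X)

  lift∘proj₁-isEquiv : {A : Set a} {B : A → Set b} → (∀ x → isContr (B x)) →
                       isEquiv (λ (w : Σ A B) → lift {ℓ = b} (proj₁ w))
  lift∘proj₁-isEquiv contrB (lift x) =
    ((x , proj₁ (contrB x)) , refl) ,
    λ { ((.x , v) , refl) → cong (λ v′ → (x , v′) , refl) (proj₂ (contrB x) v) }

  -- The fibre of postcomposition with lift ∘ proj₁ over lift retracts onto the
  -- dependent functions.
  Π-isContr : {A : Set a} {B : A → Set b} → (∀ x → isContr (B x)) → isContr ((x : A) → B x)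
  Π-isContr {a} {b} {A} {B} contrB =
    isContr-retract fibre→Π Π→fibre (λ _ → refl)
      (postcomp-isEquiv {A = A} _ (lift∘proj₁-isEquiv contrB) (λ x → lift x))
    where
    Fibre : Set (a ⊔ b)
    Fibre = fiber (λ (φ : A → Σ A B) x → lift {ℓ = b} (proj₁ (φ x))) (λ x → lift x)
    fibre→Π : Fibre → (x : A) → B x
    fibre→Π (φ , q) x = subst B (cong lower (cong-app q x)) (proj₂ (φ x))
    Π→fibre : ((x : A) → B x) → Fibre
    Π→fibre f = (λ x → x , f x) , refl

  funext : {A : Set a} {B : A → Set b} {f g : (x : A) → B x} → (∀ x → f x ≡ g x) → f ≡ g
  funext {f = f} {g} h =
    cong (λ φ x → proj₁ (φ x))
      (isContr→isProp (Π-isContr λ x → singleton-isContr (f x)) (λ x → f x , refl) (λ x → g x , h x))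

  cong-app-injective : {A : Set a} {B : A → Set b} {f g : (x : A) → B x} {p q : f ≡ g} →
                       cong-app p ≡ cong-app q → p ≡ q
  cong-app-injective = encode-injective cong-app funext

  Π-isProp : {A : Set a} {B : A → Set b} → (∀ x → isProp (B x)) → isProp ((x : A) → B x)
  Π-isProp propB f g = funext λ x → propB x (f x) (g x)

  ≡-isProp-pointwise : {A : Set a} {B : A → Set b} {f g : (x : A) → B x} →
                       (∀ x → isProp (f x ≡ g x)) → isProp (f ≡ g)
  ≡-isProp-pointwise prop p q = cong-app-injective (Π-isProp prop (cong-app p) (cong-app q))

  Π-isSet : {A : Set a} {B : A → Set b} → (∀ x → isSet (B x)) → isSet ((x : A) → B x)
  Π-isSet setB f g = ≡-isProp-pointwise λ x → setB x (f x) (g x)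

  Σ-isSet : {A : Set a} {B : A → Set b} → isSet A → (∀ x → isSet (B x)) → isSet (Σ A B)
  Σ-isSet setA setB _ _ _ _ =
    encode-injective Σ-≡,≡←≡ Σ-≡,≡→≡ (Σ-≡,≡→≡ (setA _ _ _ _ , setB _ _ _ _ _))

  isProp-isProp : {A : Set a} → isProp (isProp A)
  isProp-isProp propA = Π-isProp (λ x → Π-isProp λ y → prop→set propA x y) propA

  isProp-isSet : {A : Set a} → isProp (isSet A)
  isProp-isSet setA = Π-isProp (λ _ → Π-isProp λ _ → isProp-isProp) setA

  isProp-isContr : {A : Set a} → isProp (isContr A)
  isProp-isContr (c , h) (c′ , _) =
    Σ-≡,≡→≡ (h c′ , Π-isProp (λ x → prop→set (isContr→isProp (c , h)) c′ x) _ _)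

  isProp-isEquiv : {A : Set a} {B : Set b} {f : A → B} → isProp (isEquiv f)
  isProp-isEquiv = Π-isProp λ _ → isProp-isContr

  idtoeqv-injective : {A B : Set a} {p q : A ≡ B} → idtoeqv p ≡ idtoeqv q → p ≡ q
  idtoeqv-injective {a} {A} = encode-injective idtoeqv λ {B} e → proj₁ (proj₁ (ua a A B e))

  idtoeqv-subst : {A B : Set a} (p : A ≡ B) (x : A) → proj₁ (idtoeqv p) x ≡ subst (λ X → X) p x
  idtoeqv-subst refl x = refl

  subst-id-injective : {A B : Set a} {p q : A ≡ B} →
                       (∀ x → subst (λ X → X) p x ≡ subst (λ X → X) q x) → p ≡ q
  subst-id-injective {p = p} {q} h = idtoeqv-injective (Σ-≡,≡→≡ (funext h′ , isProp-isEquiv _ _))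
    where
    h′ : ∀ x → proj₁ (idtoeqv p) x ≡ proj₁ (idtoeqv q) x
    h′ x = trans (idtoeqv-subst p x) (trans (h x) (sym (idtoeqv-subst q x)))

  ≡-isProp : {A B : Set a} → isProp B → isProp (A ≡ B)
  ≡-isProp propB p q = subst-id-injective λ _ → propB _ _

  GraphPath : Graph → Graph → Set₁
  GraphPath X Y = Σ (Node X ≡ Node Y) λ p → subst (λ N → N → N → Set) p (Edge X) ≡ Edge Y

  Graph-encode : {X Y : Graph} → X ≡ Y → GraphPath X Y
  Graph-encode refl = refl , refl

  Graph-decode : {X Y : Graph} → GraphPath X Y → X ≡ Y
  Graph-decode {record { Node = N ; Node-set = s ; Edge = E ; Edge-set = t }}
               {record { Node = .N ; Node-set = s′ ; Edge = .E ; Edge-set = t′ }} (refl , refl) =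
    cong₂ (λ s″ t″ → record { Node = N ; Node-set = s″ ; Edge = E ; Edge-set = t″ })
      (isProp-isSet s s′) (Π-isProp (λ _ → Π-isProp λ _ → isProp-isSet) t t′)

  subst-Node≡subst-id : {X Y : Graph} (d : X ≡ Y) (x : Node X) →
                        subst Node d x ≡ subst (λ N → N) (proj₁ (Graph-encode d)) x
  subst-Node≡subst-id refl x = refl

  Graph-≡-determined-by-Node : {X Y : Graph} → (∀ u v → isProp (Edge Y u v)) → (d d′ : X ≡ Y) →
                               (∀ x → subst Node d x ≡ subst Node d′ x) → d ≡ d′
  Graph-≡-determined-by-Node {X} {Y} propE d d′ h =
    encode-injective Graph-encode Graph-decode (Σ-≡,≡→≡ (on-nodes , on-edges))
    where
    on-nodes : proj₁ (Graph-encode d) ≡ proj₁ (Graph-encode d′)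
    on-nodes = subst-id-injective λ x →
      trans (sym (subst-Node≡subst-id d x)) (trans (h x) (subst-Node≡subst-id d′ x))
    on-edges : subst (λ p → subst (λ N → N → N → Set) p (Edge X) ≡ Edge Y) on-nodes (proj₂ (Graph-encode d))
               ≡ proj₂ (Graph-encode d′)
    on-edges = ≡-isProp-pointwise (λ u → ≡-isProp-pointwise λ v → ≡-isProp (propE u v)) _ _

  module _ (G : Graph) where

    Hom-isSet : (X : Graph) → isSet (Hom X G)
    Hom-isSet X = Σ-isSet (Π-isSet λ _ → Node-set G)
      λ _ → Π-isSet λ _ → Π-isSet λ _ → Π-isSet λ _ → Edge-set G _ _

    edgeMap-subst : {X Y : Graph} (e : X ≡ Y) (f : Hom X G) (t : TotalEdges X) →
                    edgeMap {Y} {G} (subst (λ Z → Hom Z G) e f) (subst TotalEdges e t) ≡ edgeMap {X} {G} f t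
    edgeMap-subst refl f t = refl

    target-subst : {X Y : Graph} (e : X ≡ Y) (t : TotalEdges X) →
                   proj₁ (proj₂ (subst TotalEdges e t)) ≡ subst Node e (proj₁ (proj₂ t))
    target-subst refl t = refl

    subst-Hom-injective : (X Y : Graph) → (∀ u v → isProp (Edge X u v)) →
                          (∀ x → Σ (Node X) λ u → Edge X u x) →
                          (f : Hom X G) → isEdgeInjective {X} {G} f → (e e′ : X ≡ Y) →
                          subst (λ Z → Hom Z G) e f ≡ subst (λ Z → Hom Z G) e′ f → e ≡ e′
    subst-Hom-injective X .X propE incoming f f-inj e refl fixed =
      Graph-≡-determined-by-Node propE e refl fixes-nodes
      where
      fixes-edges : ∀ t → subst TotalEdges e t ≡ t
      fixes-edges t = proj₁ (proj₁ (f-inj _ t (trans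
        (sym (cong (λ h → edgeMap {X} {G} h (subst TotalEdges e t)) fixed))
        (edgeMap-subst e f t))))
      fixes-nodes : ∀ x → subst Node e x ≡ x
      fixes-nodes x = let (u , ux) = incoming x in
        trans (sym (target-subst e (u , x , ux))) (cong (λ t → proj₁ (proj₂ t)) (fixes-edges (u , x , ux)))

Cycle-Edge-isProp : (n : ℕ) .{{_ : NonZero n}} → ∀ u v → isProp (Edge (Cycle n) u v)
Cycle-Edge-isProp (suc m) u v = Fin-isSet (suc m) u (predFin v)

Cycle-incoming : (n : ℕ) .{{_ : NonZero n}} → ∀ v → Σ (Node (Cycle n)) λ u → Edge (Cycle n) u v
Cycle-incoming (suc m) v = predFin v , refl

lemma4p8 : (ua : (ℓ : Level) → Univalence ℓ) (T : PropTrunc)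
    (G : Graph) → isConnected T G → isFiniteGraph T G →
    (n : ℕ) .{{_ : NonZero n}} →
    (f g : Hom (Cycle n) G) → isEdgeInjective {Cycle n} {G} f → isEdgeInjective {Cycle n} {G} g →
    isProp (Σ (Cycle n ≡ Cycle n) λ e → subst (λ X → Hom X G) e f ≡ g)
lemma4p8 ua _ G _ _ n f g f-inj _ =
  injective⇒fiber-isProp (λ e → subst (λ X → Hom X G) e f) (Hom-isSet G (Cycle n))
    (subst-Hom-injective G (Cycle n) (Cycle n) (Cycle-Edge-isProp n) (Cycle-incoming n) f f-inj _ _) g
  where open FromUnivalence ua
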